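{- If $w\in U_n$ and $F:S_n\to S_n$ is any homing shuffle, then $i_{F(w)}\le i_w$.
   Context: $[n]=\{1,\dots,n\}$; $S_n$ is the group of bijections $[n]\to[n]$. A homing shuffle is a map $F:S_n\to S_n$ such that for every $w\in S_n$, setting $k:=w(1)$: (a) $F(w)(k)=k$, and (b) $F(w)(i)=w(i)$ for all $i>k$. For $w\in S_n$, $i_w$ is the smallest $k\in[n]$ with $w([k])=[k]$. $U_n:=\{w\in S_n : \text{there is } i>i_w \text{ with } w(i)\neq i\}$. -}

module Defs where

open import Data.Nat using (ℕ; suc; _≤_; _<_)
open import Data.Fin using (Fin; toℕ; zero)
open import Data.Fin.Permutation using (Permutation′; _⟨$⟩ʳ_)
open import Data.Product using (Σ; ∃; ∃-syntax; _×_; _,_)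
open import Relation.Binary.PropositionalEquality using (_≡_; _≢_)

-- Convention: [n] = {1,…,n} is represented by Fin n = {0,…,n-1};
-- the 1-based value v corresponds to the Fin element with toℕ = v - 1.
-- S_n is  Permutation′ n  (bijections Fin n ↔ Fin n).

Perm : ℕ → Set
Perm n = Permutation′ n

-- Homing shuffle on S_n with n = suc m (so that w(1) exists).
-- 1-based  k := w(1)  is 0-based  k := w ⟨$⟩ʳ zero;
-- "i > k" (1-based) is "toℕ k < toℕ i" (0-based).
IsHomingShuffle : ∀ {m} → (Perm (suc m) → Perm (suc m)) → Set
IsHomingShuffle {m} F =
  ∀ (w : Perm (suc m)) →
    let k = w ⟨$⟩ʳ zero in
      (F w ⟨$⟩ʳ k ≡ k)
    × (∀ (i : Fin (suc m)) → toℕ k < toℕ i → F w ⟨$⟩ʳ i ≡ w ⟨$⟩ʳ i)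

-- w([k]) = [k]  where [k] = {1,…,k}, i.e. 0-based {j | toℕ j < k}:
-- image of [k] is contained in [k], and every element of [k] is hit from [k].
PreservesInitial : ∀ {n} → Perm n → ℕ → Set
PreservesInitial {n} w k =
    (∀ (j : Fin n) → toℕ j < k → toℕ (w ⟨$⟩ʳ j) < k)
  × (∀ (j : Fin n) → toℕ j < k → ∃[ i ] (toℕ i < k × w ⟨$⟩ʳ i ≡ j))

IsIw : ∀ {n} → Perm n → ℕ → Set
IsIw {n} w k =
    (1 ≤ k) × (k ≤ n) × PreservesInitial w k
  × (∀ k' → 1 ≤ k' → PreservesInitial w k' → k ≤ k')

-- w ∈ U_n  :⇔  there is i > i_w (1-based) with w(i) ≠ i.
-- 1-based i > i_w  ⇔  0-based toℕ i ≥ i_w.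
InU : ∀ {n} → Perm n → Set
InU {n} w = ∃[ a ] (IsIw w a × ∃[ i ] (a ≤ toℕ i × w ⟨$⟩ʳ i ≢ i))

module Submission where

open import Defs
open import Data.Nat using (ℕ; suc; _≤_; _<_)
open import Data.Nat.Properties using (<-≤-trans; ≮⇒≥; ≰⇒>; <⇒≱)
open import Data.Fin using (Fin; toℕ; zero)
open import Data.Fin.Permutation using (_⟨$⟩ʳ_; _⟨$⟩ˡ_; inverseˡ; inverseʳ)
open import Data.Product using (_,_; proj₁; proj₂)
open import Relation.Binary.PropositionalEquality using (_≡_; sym; trans; cong; subst; module ≡-Reasoning)

-- A permutation preserves [a] exactly when it and its inverse preserve the complement of [a].
-- A homing shuffle F leaves w unchanged beyond w(1) ∈ [i_w], so F(w) agrees with w on the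
-- complement of [i_w] and hence also preserves [i_w]; minimality of i_F(w) gives the claim.

PreservesUpper : ∀ {n} → (Fin n → Fin n) → ℕ → Set
PreservesUpper f a = ∀ i → a ≤ toℕ i → a ≤ toℕ (f i)

module _ {n a : ℕ} where

  preservesInitial⇒preservesUpper : (π : Perm n) → PreservesInitial π a →
                                    PreservesUpper (π ⟨$⟩ʳ_) a
  preservesInitial⇒preservesUpper π (_ , onto) i a≤i = ≮⇒≥ λ πi<a →
    let (i′ , i′<a , πi′≡πi) = onto (π ⟨$⟩ʳ i) πi<a
        i′≡i = trans (sym (inverseˡ π)) (trans (cong (π ⟨$⟩ˡ_) πi′≡πi) (inverseˡ π))
    in <⇒≱ (subst (λ x → toℕ x < a) i′≡i i′<a) a≤i

  preservesInitial⇒inverse-preservesUpper : (π : Perm n) → PreservesInitial π a →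
                                            PreservesUpper (π ⟨$⟩ˡ_) a
  preservesInitial⇒inverse-preservesUpper π (into , _) i a≤i = ≮⇒≥ λ π⁻¹i<a →
    <⇒≱ (subst (λ x → toℕ x < a) (inverseʳ π) (into _ π⁻¹i<a)) a≤i

  preservesUpper⇒preservesInitial : (π : Perm n) →
                                    PreservesUpper (π ⟨$⟩ʳ_) a → PreservesUpper (π ⟨$⟩ˡ_) a →
                                    PreservesInitial π a
  preservesUpper⇒preservesInitial π upper inverse-upper =
    (λ j j<a → ≰⇒> λ a≤πj →
      <⇒≱ j<a (subst (λ x → a ≤ toℕ x) (inverseˡ π) (inverse-upper _ a≤πj))) ,
    (λ j j<a → π ⟨$⟩ˡ j , ≰⇒> (λ a≤π⁻¹j →
      <⇒≱ j<a (subst (λ x → a ≤ toℕ x) (inverseʳ π) (upper _ a≤π⁻¹j))) , inverseʳ π)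

  agreeOnUpper⇒preservesInitial : (π σ : Perm n) → PreservesInitial π a →
                                  (∀ i → a ≤ toℕ i → σ ⟨$⟩ʳ i ≡ π ⟨$⟩ʳ i) →
                                  PreservesInitial σ a
  agreeOnUpper⇒preservesInitial π σ π-preserves agree =
    preservesUpper⇒preservesInitial σ σ-upper σ-inverse-upper
    where
    π-upper : PreservesUpper (π ⟨$⟩ʳ_) a
    π-upper = preservesInitial⇒preservesUpper π π-preserves

    π-inverse-upper : PreservesUpper (π ⟨$⟩ˡ_) a
    π-inverse-upper = preservesInitial⇒inverse-preservesUpper π π-preserves

    σ-upper : PreservesUpper (σ ⟨$⟩ʳ_) a
    σ-upper i a≤i = subst (λ x → a ≤ toℕ x) (sym (agree i a≤i)) (π-upper i a≤i)

    σ⁻¹≡π⁻¹ : ∀ i → a ≤ toℕ i → σ ⟨$⟩ˡ i ≡ π ⟨$⟩ˡ i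
    σ⁻¹≡π⁻¹ i a≤i = begin
      σ ⟨$⟩ˡ i                       ≡⟨ cong (σ ⟨$⟩ˡ_) (sym (inverseʳ π)) ⟩
      σ ⟨$⟩ˡ (π ⟨$⟩ʳ (π ⟨$⟩ˡ i))      ≡⟨ cong (σ ⟨$⟩ˡ_) (sym (agree _ (π-inverse-upper i a≤i))) ⟩
      σ ⟨$⟩ˡ (σ ⟨$⟩ʳ (π ⟨$⟩ˡ i))      ≡⟨ inverseˡ σ ⟩
      π ⟨$⟩ˡ i                       ∎
      where open ≡-Reasoning

    σ-inverse-upper : PreservesUpper (σ ⟨$⟩ˡ_) a
    σ-inverse-upper i a≤i =
      subst (λ x → a ≤ toℕ x) (sym (σ⁻¹≡π⁻¹ i a≤i)) (π-inverse-upper i a≤i)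

lemma2 : ∀ (m : ℕ) (F : Perm (suc m) → Perm (suc m)) → IsHomingShuffle F →
    ∀ (w : Perm (suc m)) → InU w →
    ∀ (a b : ℕ) → IsIw w a → IsIw (F w) b → b ≤ a
lemma2 m F homing w _ a b (1≤a , _ , w-preserves , _) (_ , _ , _ , b-minimal) =
  b-minimal a 1≤a (agreeOnUpper⇒preservesInitial w (F w) w-preserves F-agrees)
  where
  w1<a : toℕ (w ⟨$⟩ʳ zero) < a
  w1<a = proj₁ w-preserves zero 1≤a

  F-agrees : ∀ i → a ≤ toℕ i → F w ⟨$⟩ʳ i ≡ w ⟨$⟩ʳ i
  F-agrees i a≤i = proj₂ (homing w) i (<-≤-trans w1<a a≤i)
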